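{- Let $(\alpha_k,\beta_k)_{k\ge0}$ be a Bailey pair relative to $q^2$. Then for every integer $p\ge1$ and every integer $n\ge1$, $$\sum_{n-1\ge n_p\ge\cdots\ge n_1\ge0}\frac{q^{(n-n_p-1)(n-n_p+1)}\beta_{n-n_p-1}}{(q)_{n_p}}\prod_{i=1}^{p-1}q^{(n-n_i-1)(n-n_i+1)}\begin{bmatrix} n_{i+1}\\ n_i\end{bmatrix} = \frac{1}{(q)_{n-1}(q^2)_{n-1}}\sum_{k=0}^{n-1}\frac{(q^{1-n})_k}{(q^{1+n})_k}(-1)^kq^{nk-\binom{k+1}{2}}\bigl(q^{p(k^2+2k)}\alpha_k\bigr)^*.$$
   Context: $q$ is an indeterminate. $(a)_n=(a;q)_n=\prod_{k=1}^n(1-aq^{k-1})$, $\begin{bmatrix} n\\ k\end{bmatrix}=\frac{(q)_n}{(q)_{n-k}(q)_k}$. A pair $(\alpha_n,\beta_n)_{n\ge0}$ is a Bailey pair relative to $a$ if $\beta_n=\sum_{k=0}^n\frac{\alpha_k}{(q)_{n-k}(aq)_{n+k}}$ for all $n\ge0$. For a sequence $(a_k)_{k\ge0}$ (here $a_k=q^{p(k^2+2k)}\alpha_k$), $a_k^*:=(1-q^2)\left(\frac{a_k}{1-q^{2k+2}}-\frac{q^{2k}a_{k-1}}{1-q^{2k}}\right)$, with the convention $a_{ -1}=0$. -}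

module Defs where

open import Level using (_⊔_)
open import Algebra.Bundles using (CommutativeRing)
open import Data.Nat as ℕ using (ℕ; zero; suc; _∸_)
open import Data.Nat.Combinatorics using (_C_)
open import Data.Integer as ℤ using (ℤ; +_; -[1+_])

-- All q-series quantities are interpreted in a commutative ring R containing q,
-- in which q and every 1 - q^m (m ≥ 1) are units, with the given inverses:
--   qinv      : inverse of q
--   uinv m    : inverse of (1 - q^(suc m))
module QSeries {c ℓ} (R : CommutativeRing c ℓ)
               (q qinv : CommutativeRing.Carrier R)
               (uinv : ℕ → CommutativeRing.Carrier R) where

  open CommutativeRing R hiding (zero)

  pow : Carrier → ℕ → Carrier
  pow x zero    = 1#
  pow x (suc n) = x * pow x n

  qpow : ℤ → Carrier
  qpow (+ n)      = pow q n
  qpow -[1+ n ]   = pow qinv (suc n)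

  sumBelow : ℕ → (ℕ → Carrier) → Carrier
  sumBelow zero    f = 0#
  sumBelow (suc n) f = sumBelow n f + f n

  prodBelow : ℕ → (ℕ → Carrier) → Carrier
  prodBelow zero    f = 1#
  prodBelow (suc n) f = prodBelow n f * f n

  poch : Carrier → ℕ → Carrier
  poch a n = prodBelow n (λ j → 1# - a * pow q j)

  -- 1 / (q^{s+1};q)_n  = Π_{j=0}^{n-1} 1/(1 - q^{s+1+j})
  invPoch : ℕ → ℕ → Carrier
  invPoch s n = prodBelow n (λ j → uinv (s ℕ.+ j))

  -- q-binomial coefficient [n choose k] = (q)_n / ((q)_{n-k} (q)_k)   (used for k ≤ n)
  qbinom : ℕ → ℕ → Carrier
  qbinom n k = poch q n * invPoch 0 (n ∸ k) * invPoch 0 k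

  -- (α,β) is a Bailey pair relative to a = q^2 (so aq = q^3):
  -- β_n = Σ_{k=0}^{n} α_k / ((q)_{n-k} (q^3)_{n+k})
  IsBaileyPairQ² : (ℕ → Carrier) → (ℕ → Carrier) → Set ℓ
  IsBaileyPairQ² α β = ∀ n →
    β n ≈ sumBelow (suc n) (λ k → α k * invPoch 0 (n ∸ k) * invPoch 2 (n ℕ.+ k))

  aSeq : ℕ → (ℕ → Carrier) → ℕ → Carrier
  aSeq p α k = pow q (p ℕ.* (k ℕ.* k ℕ.+ 2 ℕ.* k)) * α k

  -- a_k^* = (1-q^2) ( a_k/(1-q^{2k+2}) - q^{2k} a_{k-1}/(1-q^{2k}) ),  a_{-1} = 0
  star : (ℕ → Carrier) → ℕ → Carrier
  star a zero    = (1# - pow q 2) * (a zero * uinv 1)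
  star a (suc k) = (1# - pow q 2) *
    (a (suc k) * uinv (2 ℕ.* suc k ℕ.+ 1) - pow q (2 ℕ.* suc k) * a k * uinv (2 ℕ.* k ℕ.+ 1))

  f : ℕ → ℕ → Carrier
  f n m = pow q ((n ∸ m ∸ 1) ℕ.* (n ∸ m ℕ.+ 1))

  -- inner nested sum:
  -- W n j m = Σ_{m ≥ n_j ≥ ... ≥ n_1 ≥ 0} Π_{i=1}^{j} f(n_i) [n_{i+1} choose n_i],  n_{j+1} = m
  W : ℕ → ℕ → ℕ → Carrier
  W n zero    m = 1#
  W n (suc j) m = sumBelow (suc m) (λ l → f n l * qbinom m l * W n j l)

  lhs : (ℕ → Carrier) → ℕ → ℕ → Carrier
  lhs β p n = sumBelow n (λ m → f n m * β (n ∸ m ∸ 1) * invPoch 0 m * W n (p ∸ 1) m)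

  rhs : (ℕ → Carrier) → ℕ → ℕ → Carrier
  rhs α p n = invPoch 0 (n ∸ 1) * invPoch 1 (n ∸ 1) *
    sumBelow n (λ k → poch (qpow (+ 1 ℤ.- + n)) k * invPoch n k
                      * pow (- 1#) k * pow q (n ℕ.* k ∸ (suc k C 2))
                      * star (aSeq p α) k)

-- Summing out the outermost index n_p of the nested sum lowers p by one and
-- replaces β by
--   β′_N = Σ_K q^{K²+2K} β_K / (q)_{N-K},
-- the Bailey lemma for a = q² with ρ₁, ρ₂ → ∞, which turns the Bailey pair
-- (α_k, β) into (q^{k²+2k} α_k, β′).  Its key identity, a q-Chu–Vandermonde
-- sum, follows from the q-Bernstein partition of unity
--   Σ_t [s, t] A^t q^{t²} (A q^{t+1})_{s-t} = 1.
-- After p steps the left side is β_{n-1} of the Bailey pair with α-sequence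
-- a_k = q^{p(k²+2k)} α_k.  On the right, with M = n - 1, the weights
-- (q^{-M})_k (-1)^k q^{(M+1)k - C(k+1,2)} equal (q^{M-k+1})_k, which vanishes
-- at k = M + 1; summation by parts against a*_k therefore turns the right side
-- into Σ_k a_k / ((q)_{M-k} (q³)_{M+k}) = β_M.

module Submission where

open import Defs
open import Algebra.Bundles using (CommutativeRing; RawRing)
open import Algebra.Solver.Ring.AlmostCommutativeRing
  using (fromCommutativeRing; _-Raw-AlmostCommutative⟶_)
open import Data.Integer as ℤ using (+_)
open import Data.Maybe using (Maybe; just; nothing)
open import Data.Nat as ℕ using (ℕ; zero; suc; _≤_; _<_; s≤s; _∸_)
import Data.Nat.Properties as ℕ
open import Data.Nat.Combinatorics using (_C_; nCk+nC[k+1]≡[n+1]C[k+1]; nC1≡n)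
open import Data.Nat.Tactic.RingSolver using (solve-∀)
open import Data.Product using (_,_) renaming (_×_ to _⊗_)
open import Data.Sum using (inj₁; inj₂)
open import Level using (0ℓ)
open import Relation.Binary.PropositionalEquality as ≡ using (_≡_)
import Relation.Binary.Reasoning.Setoid as SetoidReasoning
open import Relation.Nullary using (yes; no)

-- Algebra.Solver.Ring for an arbitrary commutative ring, with integer
-- coefficients written as formal differences (a , b) of naturals.
module IntegerCoefficientSolver {c ℓ} (R : CommutativeRing c ℓ) where
  open CommutativeRing R
  open import Algebra.Properties.Semiring.Mult.TCOptimised semiring
    using (_×_; ×-homo-+; ×1-homo-*)
  open import Algebra.Properties.AbelianGroup +-abelianGroup
    using (ε⁻¹≈ε; ⁻¹-∙-comm; ⁻¹-anti-homo‿-)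
  open import Algebra.Properties.CommutativeSemigroup +-commutativeSemigroup
    using (interchange)
  open import Algebra.Properties.Ring ring using ([y-z]x≈yx-zx; x[y-z]≈xy-xz)
  open import Relation.Binary.Reasoning.Setoid setoid

  ℤ₂ : RawRing 0ℓ 0ℓ
  ℤ₂ = record
    { Carrier = ℕ ⊗ ℕ
    ; _≈_     = _≡_
    ; _+_     = λ { (a , b) (c , d) → a ℕ.+ c , b ℕ.+ d }
    ; _*_     = λ { (a , b) (c , d) → a ℕ.* c ℕ.+ b ℕ.* d , a ℕ.* d ℕ.+ b ℕ.* c }
    ; -_      = λ { (a , b) → b , a }
    ; 0#      = 0 , 0
    ; 1#      = 1 , 0
    }

  private
      ι : ℕ → Carrier
      ι n = n × 1#

      -- Cancelling common successors first makes (0 , 0), (1 , 0) and (0 , 1)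
      -- denote 0#, 1# and - 1# definitionally, as the solver needs.
      ⟦_⟧ : ℕ ⊗ ℕ → Carrier
      ⟦ a , zero ⟧      = ι a
      ⟦ zero , suc b ⟧  = - ι (suc b)
      ⟦ suc a , suc b ⟧ = ⟦ a , b ⟧

      [x-y]+[z-w]≈[x+z]-[y+w] : ∀ x y z w → (x - y) + (z - w) ≈ (x + z) - (y + w)
      [x-y]+[z-w]≈[x+z]-[y+w] x y z w =
        trans (interchange x (- y) z (- w)) (+-congˡ (⁻¹-∙-comm y w))

      [x-y][z-w]≈[xz+yw]-[xw+yz] : ∀ x y z w →
        (x - y) * (z - w) ≈ (x * z + y * w) - (x * w + y * z)
      [x-y][z-w]≈[xz+yw]-[xw+yz] x y z w = begin
        (x - y) * (z - w)                     ≈⟨ [y-z]x≈yx-zx (z - w) x y ⟩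
        x * (z - w) - y * (z - w)             ≈⟨ +-cong (x[y-z]≈xy-xz x z w) (-‿cong (x[y-z]≈xy-xz y z w)) ⟩
        (x * z - x * w) - (y * z - y * w)     ≈⟨ +-congˡ (⁻¹-anti-homo‿- (y * z) (y * w)) ⟩
        (x * z - x * w) + (y * w - y * z)     ≈⟨ [x-y]+[z-w]≈[x+z]-[y+w] _ _ _ _ ⟩
        (x * z + y * w) - (x * w + y * z)     ∎

      x-y≈[x+z]-[y+z] : ∀ x y z → x - y ≈ (x + z) - (y + z)
      x-y≈[x+z]-[y+z] x y z = begin
        x - y                 ≈⟨ sym (+-identityʳ _) ⟩
        (x - y) + 0#          ≈⟨ +-congˡ (sym (-‿inverseʳ z)) ⟩
        (x - y) + (z - z)     ≈⟨ [x-y]+[z-w]≈[x+z]-[y+w] x y z z ⟩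
        (x + z) - (y + z)     ∎

      ι-difference-cong : ∀ a b c d → a ℕ.+ d ≡ c ℕ.+ b → ι a - ι b ≈ ι c - ι d
      ι-difference-cong a b c d a+d≡c+b = begin
        ι a - ι b                     ≈⟨ x-y≈[x+z]-[y+z] (ι a) (ι b) (ι d) ⟩
        (ι a + ι d) - (ι b + ι d)     ≈⟨ +-cong (sym (×-homo-+ 1# a d)) (-‿cong (+-comm _ _)) ⟩
        ι (a ℕ.+ d) - (ι d + ι b)     ≈⟨ +-congʳ (reflexive (≡.cong ι a+d≡c+b)) ⟩
        ι (c ℕ.+ b) - (ι d + ι b)     ≈⟨ +-congʳ (×-homo-+ 1# c b) ⟩
        (ι c + ι b) - (ι d + ι b)     ≈⟨ sym (x-y≈[x+z]-[y+z] (ι c) (ι d) (ι b)) ⟩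
        ι c - ι d                     ∎

      ⟦⟧≈ι-ι : ∀ a b → ⟦ a , b ⟧ ≈ ι a - ι b
      ⟦⟧≈ι-ι a       zero    = begin
        ι a        ≈⟨ sym (+-identityʳ _) ⟩
        ι a + 0#   ≈⟨ +-congˡ (sym ε⁻¹≈ε) ⟩
        ι a - 0#   ∎
      ⟦⟧≈ι-ι zero    (suc b) = sym (+-identityˡ _)
      ⟦⟧≈ι-ι (suc a) (suc b) = trans (⟦⟧≈ι-ι a b) (ι-difference-cong a b (suc a) (suc b) (ℕ.+-suc a b))

  homomorphism : ℤ₂ -Raw-AlmostCommutative⟶ fromCommutativeRing R
  homomorphism = record
    { ⟦_⟧    = ⟦_⟧
    ; +-homo = λ { (a , b) (c , d) → begin
        ⟦ a ℕ.+ c , b ℕ.+ d ⟧                 ≈⟨ ⟦⟧≈ι-ι (a ℕ.+ c) (b ℕ.+ d) ⟩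
        ι (a ℕ.+ c) - ι (b ℕ.+ d)             ≈⟨ +-cong (×-homo-+ 1# a c) (-‿cong (×-homo-+ 1# b d)) ⟩
        (ι a + ι c) - (ι b + ι d)             ≈⟨ sym ([x-y]+[z-w]≈[x+z]-[y+w] _ _ _ _) ⟩
        (ι a - ι b) + (ι c - ι d)             ≈⟨ sym (+-cong (⟦⟧≈ι-ι a b) (⟦⟧≈ι-ι c d)) ⟩
        ⟦ a , b ⟧ + ⟦ c , d ⟧                 ∎ }
    ; *-homo = λ { (a , b) (c , d) → begin
        ⟦ a ℕ.* c ℕ.+ b ℕ.* d , a ℕ.* d ℕ.+ b ℕ.* c ⟧
          ≈⟨ ⟦⟧≈ι-ι (a ℕ.* c ℕ.+ b ℕ.* d) (a ℕ.* d ℕ.+ b ℕ.* c) ⟩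
        ι (a ℕ.* c ℕ.+ b ℕ.* d) - ι (a ℕ.* d ℕ.+ b ℕ.* c)
          ≈⟨ +-cong (ι-+-* a c b d) (-‿cong (ι-+-* a d b c)) ⟩
        (ι a * ι c + ι b * ι d) - (ι a * ι d + ι b * ι c)
          ≈⟨ sym ([x-y][z-w]≈[xz+yw]-[xw+yz] _ _ _ _) ⟩
        (ι a - ι b) * (ι c - ι d)             ≈⟨ sym (*-cong (⟦⟧≈ι-ι a b) (⟦⟧≈ι-ι c d)) ⟩
        ⟦ a , b ⟧ * ⟦ c , d ⟧                 ∎ }
    ; -‿homo = λ { (a , b) → begin
        ⟦ b , a ⟧        ≈⟨ ⟦⟧≈ι-ι b a ⟩
        ι b - ι a        ≈⟨ sym (⁻¹-anti-homo‿- (ι a) (ι b)) ⟩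
        - (ι a - ι b)    ≈⟨ -‿cong (sym (⟦⟧≈ι-ι a b)) ⟩
        - ⟦ a , b ⟧      ∎ }
    ; 0-homo = refl
    ; 1-homo = refl
    }
    where
    ι-+-* : ∀ a b c d → ι (a ℕ.* b ℕ.+ c ℕ.* d) ≈ ι a * ι b + ι c * ι d
    ι-+-* a b c d = trans (×-homo-+ 1# (a ℕ.* b) (c ℕ.* d)) (+-cong (×1-homo-* a b) (×1-homo-* c d))

  _≟_ : ∀ x y → Maybe (⟦ x ⟧ ≈ ⟦ y ⟧)
  (a , b) ≟ (c , d) with a ℕ.+ d ℕ.≟ c ℕ.+ b
  ... | yes a+d≡c+b = just (trans (⟦⟧≈ι-ι a b) (trans (ι-difference-cong a b c d a+d≡c+b) (sym (⟦⟧≈ι-ι c d))))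
  ... | no _        = nothing

  open import Algebra.Solver.Ring ℤ₂ (fromCommutativeRing R) homomorphism _≟_ public
    using (solve; _:=_; _:+_; _:*_; _:-_; con)

[1+M]∸m∸1≡M∸m : ∀ M m → suc M ∸ m ∸ 1 ≡ M ∸ m
[1+M]∸m∸1≡M∸m M m = ≡.trans (ℕ.∸-+-assoc (suc M) m 1) (≡.cong (suc M ∸_) (ℕ.+-comm m 1))

descendingSum : ℕ → ℕ → ℕ
descendingSum M zero    = 0
descendingSum M (suc k) = descendingSum M k ℕ.+ (M ∸ k)

[1+k]C2+descendingSum≡[1+M]*k : ∀ {M k} → k ≤ suc M → suc k C 2 ℕ.+ descendingSum M k ≡ suc M ℕ.* k
[1+k]C2+descendingSum≡[1+M]*k {M} {zero}  _         = ≡.sym (ℕ.*-zeroʳ M)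
[1+k]C2+descendingSum≡[1+M]*k {M} {suc k} (s≤s k≤M) = begin
  suc (suc k) C 2 ℕ.+ (descendingSum M k ℕ.+ (M ∸ k))
    ≡⟨ ≡.cong (ℕ._+ (descendingSum M k ℕ.+ (M ∸ k))) (≡.sym (nCk+nC[k+1]≡[n+1]C[k+1] (suc k) 1)) ⟩
  (suc k C 1 ℕ.+ suc k C 2) ℕ.+ (descendingSum M k ℕ.+ (M ∸ k))
    ≡⟨ ≡.cong (λ m → (m ℕ.+ suc k C 2) ℕ.+ (descendingSum M k ℕ.+ (M ∸ k))) (nC1≡n (suc k)) ⟩
  (suc k ℕ.+ suc k C 2) ℕ.+ (descendingSum M k ℕ.+ (M ∸ k))
    ≡⟨ rearrange k (suc k C 2) (descendingSum M k) (M ∸ k) ⟩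
  (suc k C 2 ℕ.+ descendingSum M k) ℕ.+ suc (k ℕ.+ (M ∸ k))
    ≡⟨ ≡.cong₂ (λ a b → a ℕ.+ suc b) ([1+k]C2+descendingSum≡[1+M]*k (ℕ.m≤n⇒m≤1+n k≤M)) (ℕ.m+[n∸m]≡n k≤M) ⟩
  suc M ℕ.* k ℕ.+ suc M
    ≡⟨ ℕ.+-comm (suc M ℕ.* k) (suc M) ⟩
  suc M ℕ.+ suc M ℕ.* k
    ≡⟨ ℕ.*-suc (suc M) k ⟨
  suc M ℕ.* suc k
    ∎
  where
  open ≡.≡-Reasoning
  rearrange : ∀ k c d r → (suc k ℕ.+ c) ℕ.+ (d ℕ.+ r) ≡ (c ℕ.+ d) ℕ.+ suc (k ℕ.+ r)
  rearrange = solve-∀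

[1+M]*k∸[1+k]C2≡descendingSum : ∀ {M k} → k ≤ suc M → suc M ℕ.* k ∸ suc k C 2 ≡ descendingSum M k
[1+M]*k∸[1+k]C2≡descendingSum {M} {k} k≤1+M = ≡.trans
  (≡.cong (_∸ suc k C 2) (≡.sym ([1+k]C2+descendingSum≡[1+M]*k k≤1+M)))
  (ℕ.m+n∸m≡n (suc k C 2) (descendingSum M k))

module QSeriesProperties {c ℓ} (R : CommutativeRing c ℓ)
  (q qinv : CommutativeRing.Carrier R) (uinv : ℕ → CommutativeRing.Carrier R) where

  open CommutativeRing R hiding (zero)
  open QSeries R q qinv uinv
  open IntegerCoefficientSolver R
  open import Relation.Binary.Reasoning.Setoid setoid

  sumBelow-cong< : ∀ n {g h : ℕ → Carrier} → (∀ k → k < n → g k ≈ h k) →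
                   sumBelow n g ≈ sumBelow n h
  sumBelow-cong< zero    g≈h = refl
  sumBelow-cong< (suc n) g≈h =
    +-cong (sumBelow-cong< n (λ k k<n → g≈h k (ℕ.m<n⇒m<1+n k<n))) (g≈h n ℕ.≤-refl)

  sumBelow-cong : ∀ n {g h : ℕ → Carrier} → (∀ k → g k ≈ h k) → sumBelow n g ≈ sumBelow n h
  sumBelow-cong n g≈h = sumBelow-cong< n (λ k _ → g≈h k)

  sumBelow-distrib-+ : ∀ n (g h : ℕ → Carrier) →
                       sumBelow n (λ k → g k + h k) ≈ sumBelow n g + sumBelow n h
  sumBelow-distrib-+ zero    g h = sym (+-identityˡ 0#)
  sumBelow-distrib-+ (suc n) g h = begin
    sumBelow n (λ k → g k + h k) + (g n + h n)   ≈⟨ +-congʳ (sumBelow-distrib-+ n g h) ⟩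
    (sumBelow n g + sumBelow n h) + (g n + h n)
      ≈⟨ solve 4 (λ a b x y → (a :+ b) :+ (x :+ y) := (a :+ x) :+ (b :+ y)) refl _ _ _ _ ⟩
    (sumBelow n g + g n) + (sumBelow n h + h n)  ∎

  *-distribˡ-sumBelow : ∀ n x (g : ℕ → Carrier) → x * sumBelow n g ≈ sumBelow n (λ k → x * g k)
  *-distribˡ-sumBelow zero    x g = zeroʳ x
  *-distribˡ-sumBelow (suc n) x g = trans (distribˡ x _ _) (+-congʳ (*-distribˡ-sumBelow n x g))

  *-distribʳ-sumBelow : ∀ n x (g : ℕ → Carrier) → sumBelow n g * x ≈ sumBelow n (λ k → g k * x)
  *-distribʳ-sumBelow n x g = begin
    sumBelow n g * x              ≈⟨ *-comm _ x ⟩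
    x * sumBelow n g              ≈⟨ *-distribˡ-sumBelow n x g ⟩
    sumBelow n (λ k → x * g k)    ≈⟨ sumBelow-cong n (λ k → *-comm x (g k)) ⟩
    sumBelow n (λ k → g k * x)    ∎

  sumBelow-sucˡ : ∀ n (g : ℕ → Carrier) → sumBelow (suc n) g ≈ g 0 + sumBelow n (λ k → g (suc k))
  sumBelow-sucˡ zero    g = trans (+-identityˡ _) (sym (+-identityʳ _))
  sumBelow-sucˡ (suc n) g = trans (+-congʳ (sumBelow-sucˡ n g)) (+-assoc _ _ _)

  sumBelow-reverse : ∀ n (g : ℕ → Carrier) → sumBelow n g ≈ sumBelow n (λ k → g (n ∸ suc k))
  sumBelow-reverse zero    g = refl
  sumBelow-reverse (suc n) g = begin
    sumBelow n g + g n                          ≈⟨ +-comm _ _ ⟩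
    g n + sumBelow n g                          ≈⟨ +-congˡ (sumBelow-reverse n g) ⟩
    g n + sumBelow n (λ k → g (n ∸ suc k))      ≈⟨ sumBelow-sucˡ n (λ k → g (suc n ∸ suc k)) ⟨
    sumBelow (suc n) (λ k → g (suc n ∸ suc k))  ∎

  sumBelow-triangle-comm : ∀ n (g : ℕ → ℕ → Carrier) →
    sumBelow n (λ m → sumBelow (suc m) (g m)) ≈
    sumBelow n (λ l → sumBelow (n ∸ l) (λ t → g (l ℕ.+ t) l))
  sumBelow-triangle-comm zero    g = refl
  sumBelow-triangle-comm (suc n) g = begin
    sumBelow n (λ m → sumBelow (suc m) (g m)) + (sumBelow n (g n) + g n n)
      ≈⟨ +-congʳ (sumBelow-triangle-comm n g) ⟩
    sumBelow n (column n) + (sumBelow n (g n) + g n n)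
      ≈⟨ +-assoc _ _ _ ⟨
    (sumBelow n (column n) + sumBelow n (g n)) + g n n
      ≈⟨ +-congʳ (sumBelow-distrib-+ n (column n) (g n)) ⟨
    sumBelow n (λ l → column n l + g n l) + g n n
      ≈⟨ +-cong (sumBelow-cong< n extend) (sym (+-identityˡ _)) ⟩
    sumBelow n (column (suc n)) + (0# + g n n)
      ≡⟨ ≡.cong (λ m → sumBelow n (column (suc n)) + (0# + g m n)) (ℕ.+-identityʳ n) ⟨
    sumBelow n (column (suc n)) + sumBelow 1 (λ t → g (n ℕ.+ t) n)
      ≡⟨ ≡.cong (λ m → sumBelow n (column (suc n)) + sumBelow m (λ t → g (n ℕ.+ t) n)) (ℕ.m+n∸n≡m 1 n) ⟨
    sumBelow n (column (suc n)) + column (suc n) n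
      ∎
    where
    column : ℕ → ℕ → Carrier
    column m l = sumBelow (m ∸ l) (λ t → g (l ℕ.+ t) l)
    extend : ∀ l → l < n → column n l + g n l ≈ column (suc n) l
    extend l l<n rewrite ℕ.+-∸-assoc 1 (ℕ.<⇒≤ l<n) =
      +-congˡ (reflexive (≡.cong (λ m → g m l) (≡.sym (ℕ.m+[n∸m]≡n (ℕ.<⇒≤ l<n)))))

  prodBelow-cong : ∀ n {g h : ℕ → Carrier} → (∀ k → g k ≈ h k) → prodBelow n g ≈ prodBelow n h
  prodBelow-cong zero    g≈h = refl
  prodBelow-cong (suc n) g≈h = *-cong (prodBelow-cong n g≈h) (g≈h n)

  prodBelow-+ : ∀ m n (g : ℕ → Carrier) →
                prodBelow (m ℕ.+ n) g ≈ prodBelow m g * prodBelow n (λ j → g (m ℕ.+ j))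
  prodBelow-+ m zero    g rewrite ℕ.+-identityʳ m = sym (*-identityʳ _)
  prodBelow-+ m (suc n) g rewrite ℕ.+-suc m n =
    trans (*-congʳ (prodBelow-+ m n g)) (*-assoc _ _ _)

  prodBelow-sucˡ : ∀ n (g : ℕ → Carrier) → prodBelow (suc n) g ≈ g 0 * prodBelow n (λ k → g (suc k))
  prodBelow-sucˡ zero    g = trans (*-identityˡ _) (sym (*-identityʳ _))
  prodBelow-sucˡ (suc n) g = trans (*-congʳ (prodBelow-sucˡ n g)) (*-assoc _ _ _)

  pow-congʳ : ∀ x {m n} → m ≡ n → pow x m ≈ pow x n
  pow-congʳ x m≡n = reflexive (≡.cong (pow x) m≡n)

  pow-distribˡ-+-* : ∀ x m n → pow x (m ℕ.+ n) ≈ pow x m * pow x n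
  pow-distribˡ-+-* x zero    n = sym (*-identityˡ _)
  pow-distribˡ-+-* x (suc m) n = trans (*-congˡ (pow-distribˡ-+-* x m n)) (sym (*-assoc _ _ _))

  pow-distribʳ-* : ∀ x y n → pow (x * y) n ≈ pow x n * pow y n
  pow-distribʳ-* x y zero    = sym (*-identityˡ _)
  pow-distribʳ-* x y (suc n) = trans (*-congˡ (pow-distribʳ-* x y n))
    (solve 4 (λ a b c d → (a :* b) :* (c :* d) := (a :* c) :* (b :* d)) refl _ _ _ _)

  pow-*-assoc : ∀ x m n → pow (pow x m) n ≈ pow x (m ℕ.* n)
  pow-*-assoc x m zero    = pow-congʳ x (≡.sym (ℕ.*-zeroʳ m))
  pow-*-assoc x m (suc n) = begin
    pow x m * pow (pow x m) n    ≈⟨ *-congˡ (pow-*-assoc x m n) ⟩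
    pow x m * pow x (m ℕ.* n)    ≈⟨ pow-distribˡ-+-* x m _ ⟨
    pow x (m ℕ.+ m ℕ.* n)        ≡⟨ ≡.cong (pow x) (ℕ.*-suc m n) ⟨
    pow x (m ℕ.* suc n)          ∎

  q^[s∸t]*q^[1+t]≈q^[1+s] : ∀ {s t} → t ≤ s → pow q (s ∸ t) * pow q (suc t) ≈ pow q (suc s)
  q^[s∸t]*q^[1+t]≈q^[1+s] {s} {t} t≤s = begin
    pow q (s ∸ t) * pow q (suc t)   ≈⟨ pow-distribˡ-+-* q (s ∸ t) (suc t) ⟨
    pow q (s ∸ t ℕ.+ suc t)         ≡⟨ ≡.cong (pow q) (≡.trans (ℕ.+-suc (s ∸ t) t) (≡.cong suc (ℕ.m∸n+n≡m t≤s))) ⟩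
    pow q (suc s)                   ∎

  poch-congˡ : ∀ {x y} n → x ≈ y → poch x n ≈ poch y n
  poch-congˡ n x≈y = prodBelow-cong n (λ j → +-congˡ (-‿cong (*-congʳ x≈y)))

  -- (q^{s+1}; q)_n; it is inverted by invPoch s n, and qPoch 0 n is poch q n definitionally.
  qPoch : ℕ → ℕ → Carrier
  qPoch s n = prodBelow n (λ j → 1# - pow q (suc (s ℕ.+ j)))

  poch-pow≈qPoch : ∀ s n → poch (pow q (suc s)) n ≈ qPoch s n
  poch-pow≈qPoch s n = prodBelow-cong n (λ j → +-congˡ (-‿cong (sym (pow-distribˡ-+-* q (suc s) j))))

  invPoch-+ : ∀ s m n → invPoch s (m ℕ.+ n) ≈ invPoch s m * invPoch (s ℕ.+ m) n
  invPoch-+ s m n = trans (prodBelow-+ m n (λ j → uinv (s ℕ.+ j)))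
    (*-congˡ (prodBelow-cong n (λ j → reflexive (≡.cong uinv (≡.sym (ℕ.+-assoc s m j))))))

  invPoch-sucˡ : ∀ s n → invPoch s (suc n) ≈ uinv s * invPoch (suc s) n
  invPoch-sucˡ s n = trans (prodBelow-sucˡ n (λ j → uinv (s ℕ.+ j)))
    (*-cong (reflexive (≡.cong uinv (ℕ.+-identityʳ s)))
            (prodBelow-cong n (λ j → reflexive (≡.cong uinv (ℕ.+-suc s j)))))

  -- The Gaussian binomial [s, t] as a polynomial in q, so that no inverses are needed.
  gauss : ℕ → ℕ → Carrier
  gauss s       zero    = 1#
  gauss zero    (suc t) = 0#
  gauss (suc s) (suc t) = gauss s (suc t) + pow q (s ∸ t) * gauss s t

  gauss-vanishes : ∀ {s t} → s < t → gauss s t ≈ 0#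
  gauss-vanishes {zero}  {suc t} _         = refl
  gauss-vanishes {suc s} {suc t} (s≤s s<t) = begin
    gauss s (suc t) + pow q (s ∸ t) * gauss s t
      ≈⟨ +-cong (gauss-vanishes (ℕ.m<n⇒m<1+n s<t)) (*-congˡ (gauss-vanishes s<t)) ⟩
    0# + pow q (s ∸ t) * 0#
      ≈⟨ trans (+-identityˡ _) (zeroʳ _) ⟩
    0#
      ∎

  gauss-diagonal : ∀ s → gauss s s ≈ 1#
  gauss-diagonal zero    = refl
  gauss-diagonal (suc s) = begin
    gauss s (suc s) + pow q (s ∸ s) * gauss s s
      ≈⟨ +-cong (gauss-vanishes {s} ℕ.≤-refl) (*-cong (pow-congʳ q (ℕ.n∸n≡0 s)) (gauss-diagonal s)) ⟩
    0# + 1# * 1#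
      ≈⟨ trans (+-identityˡ _) (*-identityˡ 1#) ⟩
    1#
      ∎

  gauss*qPoch*qPoch : ∀ {s t} → t ≤ s → gauss s t * qPoch 0 t * qPoch 0 (s ∸ t) ≈ qPoch 0 s
  gauss*qPoch*qPoch {s}     {zero}  _         = trans (*-congʳ (*-identityˡ 1#)) (*-identityˡ _)
  gauss*qPoch*qPoch {suc s} {suc t} (s≤s t≤s) with ℕ.m≤n⇒m<n∨m≡n t≤s
  ... | inj₂ ≡.refl = begin
    gauss (suc s) (suc s) * qPoch 0 (suc s) * qPoch 0 (s ∸ s)
      ≈⟨ *-cong (*-congʳ (gauss-diagonal (suc s))) (reflexive (≡.cong (qPoch 0) (ℕ.n∸n≡0 s))) ⟩
    1# * qPoch 0 (suc s) * 1#
      ≈⟨ trans (*-identityʳ _) (*-identityˡ _) ⟩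
    qPoch 0 (suc s)
      ∎
  ... | inj₁ t<s = begin
    (gauss s (suc t) + e * gauss s t) * (qPoch 0 t * dₜ) * qPoch 0 (s ∸ t)
      ≡⟨ ≡.cong (λ m → (gauss s (suc t) + e * gauss s t) * (qPoch 0 t * dₜ) * qPoch 0 m) (ℕ.+-∸-assoc 1 t<s) ⟩
    (gauss s (suc t) + e * gauss s t) * (qPoch 0 t * dₜ) * (qPoch 0 (s ∸ suc t) * dₛ₋ₜ)
      ≈⟨ solve 7 (λ a b x y z w v → (a :+ x :* b) :* (y :* z) :* (w :* v)
                    := (a :* (y :* z) :* w) :* v :+ x :* z :* (b :* y :* (w :* v))) refl _ _ _ _ _ _ _ ⟩
    (gauss s (suc t) * qPoch 0 (suc t) * qPoch 0 (s ∸ suc t)) * dₛ₋ₜ + e * dₜ * (gauss s t * qPoch 0 t * (qPoch 0 (s ∸ suc t) * dₛ₋ₜ))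
      ≈⟨ +-congˡ (*-congˡ (*-congˡ (reflexive (≡.cong (qPoch 0) (ℕ.+-∸-assoc 1 t<s))))) ⟨
    (gauss s (suc t) * qPoch 0 (suc t) * qPoch 0 (s ∸ suc t)) * dₛ₋ₜ + e * dₜ * (gauss s t * qPoch 0 t * qPoch 0 (s ∸ t))
      ≈⟨ +-cong (*-congʳ (gauss*qPoch*qPoch t<s)) (*-congˡ (gauss*qPoch*qPoch t≤s)) ⟩
    qPoch 0 s * dₛ₋ₜ + e * dₜ * qPoch 0 s
      ≡⟨ ≡.cong (λ m → qPoch 0 s * (1# - pow q m) + e * dₜ * qPoch 0 s) (ℕ.+-∸-assoc 1 t<s) ⟨
    qPoch 0 s * (1# - e) + e * dₜ * qPoch 0 s
      ≈⟨ solve 3 (λ a x y → a :* (con (1 , 0) :- x) :+ x :* (con (1 , 0) :- y) :* a := a :* (con (1 , 0) :- x :* y))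
               refl (qPoch 0 s) e (q * pow q t) ⟩
    qPoch 0 s * (1# - e * (q * pow q t))
      ≈⟨ *-congˡ (+-congˡ (-‿cong (q^[s∸t]*q^[1+t]≈q^[1+s] t≤s))) ⟩
    qPoch 0 (suc s)
      ∎
    where
    e dₜ dₛ₋ₜ : Carrier
    e = pow q (s ∸ t)
    dₜ = 1# - q * pow q t
    dₛ₋ₜ = 1# - q * pow q (s ∸ suc t)

  -- A q-analogue of the Bernstein polynomial  C(s,t) A^t (1 - A)^{s-t}.
  qBernstein : ℕ → Carrier → ℕ → Carrier
  qBernstein s A t = gauss s t * pow A t * pow q (t ℕ.* t) * poch (A * pow q (suc t)) (s ∸ t)

  qBernstein-extend : ∀ {s t} A → t ≤ s →
    gauss s t * pow A t * pow q (t ℕ.* t) * poch (A * pow q (suc t)) (suc s ∸ t) ≈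
    qBernstein s A t * (1# - A * pow q (suc s))
  qBernstein-extend {s} {t} A t≤s = begin
    w * poch x (suc s ∸ t)                     ≡⟨ ≡.cong (λ m → w * poch x m) (ℕ.+-∸-assoc 1 t≤s) ⟩
    w * (poch x (s ∸ t) * (1# - x * pow q (s ∸ t)))  ≈⟨ *-assoc _ _ _ ⟨
    qBernstein s A t * (1# - x * pow q (s ∸ t))       ≈⟨ *-congˡ (+-congˡ (-‿cong x·qˢ⁻ᵗ≈A·qˢ⁺¹)) ⟩
    qBernstein s A t * (1# - A * pow q (suc s))       ∎
    where
    w x : Carrier
    w = gauss s t * pow A t * pow q (t ℕ.* t)
    x = A * pow q (suc t)
    x·qˢ⁻ᵗ≈A·qˢ⁺¹ : x * pow q (s ∸ t) ≈ A * pow q (suc s)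
    x·qˢ⁻ᵗ≈A·qˢ⁺¹ = trans (*-assoc _ _ _) (*-congˡ (trans (*-comm _ _) (q^[s∸t]*q^[1+t]≈q^[1+s] t≤s)))

  qBernstein-shift : ∀ {s t} A → t ≤ s →
    pow q (s ∸ t) * gauss s t * pow A (suc t) * pow q (suc t ℕ.* suc t) * poch (A * pow q (suc (suc t))) (s ∸ t) ≈
    A * pow q (suc s) * qBernstein s (A * q) t
  qBernstein-shift {s} {t} A t≤s = begin
    e * g * (A * pow A t) * Q * P
      ≈⟨ solve 6 (λ e g a aᵗ Q P → e :* g :* (a :* aᵗ) :* Q :* P := (e :* Q) :* (g :* (a :* aᵗ) :* P)) refl _ _ _ _ _ _ ⟩
    (e * Q) * (g * (A * pow A t) * P)
      ≈⟨ *-congʳ eQ ⟩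
    (pow q (suc s) * (pow q t * pow q (t ℕ.* t))) * (g * (A * pow A t) * P)
      ≈⟨ solve 7 (λ qˢ qᵗ qᵗᵗ g a aᵗ P → (qˢ :* (qᵗ :* qᵗᵗ)) :* (g :* (a :* aᵗ) :* P)
                                         := (a :* qˢ) :* (g :* (aᵗ :* qᵗ) :* qᵗᵗ :* P))
               refl _ _ _ _ _ _ _ ⟩
    A * pow q (suc s) * (g * (pow A t * pow q t) * pow q (t ℕ.* t) * P)
      ≈⟨ *-congˡ (*-cong (*-congʳ (*-congˡ (pow-distribʳ-* A q t))) poch[Aq]≈P) ⟨
    A * pow q (suc s) * qBernstein s (A * q) t
      ∎
    where
    e g Q P : Carrier
    e = pow q (s ∸ t)
    g = gauss s t
    Q = pow q (suc t ℕ.* suc t)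
    P = poch (A * pow q (suc (suc t))) (s ∸ t)
    eQ : e * Q ≈ pow q (suc s) * (pow q t * pow q (t ℕ.* t))
    eQ = begin
      e * Q                                        ≈⟨ pow-distribˡ-+-* q (s ∸ t) _ ⟨
      pow q (s ∸ t ℕ.+ suc t ℕ.* suc t)            ≡⟨ ≡.cong (pow q) (exponent (s ∸ t) t) ⟩
      pow q (suc (s ∸ t ℕ.+ t) ℕ.+ (t ℕ.+ t ℕ.* t)) ≡⟨ ≡.cong (λ m → pow q (suc m ℕ.+ (t ℕ.+ t ℕ.* t))) (ℕ.m∸n+n≡m t≤s) ⟩
      pow q (suc s ℕ.+ (t ℕ.+ t ℕ.* t))            ≈⟨ trans (pow-distribˡ-+-* q (suc s) _) (*-congˡ (pow-distribˡ-+-* q t _)) ⟩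
      pow q (suc s) * (pow q t * pow q (t ℕ.* t))  ∎
      where
      exponent : ∀ u t → u ℕ.+ suc t ℕ.* suc t ≡ suc (u ℕ.+ t) ℕ.+ (t ℕ.+ t ℕ.* t)
      exponent = solve-∀
    poch[Aq]≈P : poch ((A * q) * pow q (suc t)) (s ∸ t) ≈ P
    poch[Aq]≈P = prodBelow-cong (s ∸ t) (λ j → +-congˡ (-‿cong (*-congʳ
           (solve 3 (λ a x p → (a :* x) :* (x :* p) := a :* (x :* (x :* p))) refl A q (pow q t)))))

  qBernstein-sum-suc : ∀ s A →
    sumBelow (suc (suc s)) (qBernstein (suc s) A) ≈
    sumBelow (suc s) (qBernstein s A) * (1# - A * pow q (suc s)) +
    A * pow q (suc s) * sumBelow (suc s) (qBernstein s (A * q))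
  qBernstein-sum-suc s A = begin
    sumBelow (suc (suc s)) (qBernstein (suc s) A)
      ≈⟨ sumBelow-sucˡ (suc s) _ ⟩
    first 0 + sumBelow (suc s) (λ t → qBernstein (suc s) A (suc t))
      ≈⟨ +-congˡ (sumBelow-cong (suc s) qPascal) ⟩
    first 0 + sumBelow (suc s) (λ t → first (suc t) + second t)
      ≈⟨ +-congˡ (sumBelow-distrib-+ (suc s) _ _) ⟩
    first 0 + (sumBelow (suc s) (λ t → first (suc t)) + sumBelow (suc s) second)
      ≈⟨ +-assoc _ _ _ ⟨
    (first 0 + sumBelow (suc s) (λ t → first (suc t))) + sumBelow (suc s) second
      ≈⟨ +-congʳ (sumBelow-sucˡ (suc s) first) ⟨
    (sumBelow (suc s) first + first (suc s)) + sumBelow (suc s) second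
      ≈⟨ +-cong (+-cong (sumBelow-cong< (suc s) (λ t t<1+s → qBernstein-extend A (ℕ.≤-pred t<1+s))) first-top)
                (sumBelow-cong< (suc s) (λ t t<1+s → qBernstein-shift A (ℕ.≤-pred t<1+s))) ⟩
    (sumBelow (suc s) (λ t → qBernstein s A t * (1# - x)) + 0#) + sumBelow (suc s) (λ t → x * qBernstein s (A * q) t)
      ≈⟨ +-cong (trans (+-identityʳ _) (sym (*-distribʳ-sumBelow (suc s) _ _))) (sym (*-distribˡ-sumBelow (suc s) _ _)) ⟩
    sumBelow (suc s) (qBernstein s A) * (1# - x) + x * sumBelow (suc s) (qBernstein s (A * q))
      ∎
    where
    x : Carrier
    x = A * pow q (suc s)
    first : ℕ → Carrier
    first t = gauss s t * pow A t * pow q (t ℕ.* t) * poch (A * pow q (suc t)) (suc s ∸ t)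
    second : ℕ → Carrier
    second t = pow q (s ∸ t) * gauss s t * pow A (suc t) * pow q (suc t ℕ.* suc t) * poch (A * pow q (suc (suc t))) (s ∸ t)
    qPascal : ∀ t → qBernstein (suc s) A (suc t) ≈ first (suc t) + second t
    qPascal t = solve 6 (λ a e b c d f → (a :+ e :* b) :* c :* d :* f := a :* c :* d :* f :+ e :* b :* c :* d :* f) refl _ _ _ _ _ _
    first-top : first (suc s) ≈ 0#
    first-top = trans (*-congʳ (*-congʳ (*-congʳ (gauss-vanishes {s} ℕ.≤-refl))))
                      (trans (*-congʳ (*-congʳ (zeroˡ _))) (trans (*-congʳ (zeroˡ _)) (zeroˡ _)))

  qBernstein-sum : ∀ s A → sumBelow (suc s) (qBernstein s A) ≈ 1#
  qBernstein-sum zero    A = trans (+-identityˡ _) (trans (*-identityʳ _) (trans (*-identityʳ _) (*-identityʳ _)))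
  qBernstein-sum (suc s) A = begin
    sumBelow (suc (suc s)) (qBernstein (suc s) A)
      ≈⟨ qBernstein-sum-suc s A ⟩
    sumBelow (suc s) (qBernstein s A) * (1# - x) + x * sumBelow (suc s) (qBernstein s (A * q))
      ≈⟨ +-cong (*-congʳ (qBernstein-sum s A)) (*-congˡ (qBernstein-sum s (A * q))) ⟩
    1# * (1# - x) + x * 1#
      ≈⟨ solve 1 (λ x → con (1 , 0) :* (con (1 , 0) :- x) :+ x :* con (1 , 0) := con (1 , 0)) refl x ⟩
    1#
      ∎
    where
    x : Carrier
    x = A * pow q (suc s)

  baileyWeight : ℕ → Carrier
  baileyWeight k = pow q (k ℕ.* k ℕ.+ 2 ℕ.* k)

  baileyβ : (ℕ → Carrier) → ℕ → Carrier
  baileyβ α N = sumBelow (suc N) (λ k → α k * invPoch 0 (N ∸ k) * invPoch 2 (N ℕ.+ k))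

  baileyTransform : (ℕ → Carrier) → ℕ → Carrier
  baileyTransform β N = sumBelow (suc N) (λ K → baileyWeight K * β K * invPoch 0 (N ∸ K))

  baileyβ-cong : ∀ {α γ} N → (∀ k → α k ≈ γ k) → baileyβ α N ≈ baileyβ γ N
  baileyβ-cong N α≈γ = sumBelow-cong (suc N) (λ k → *-congʳ (*-congʳ (α≈γ k)))

  baileyTransform-cong : ∀ {β γ} N → (∀ k → β k ≈ γ k) → baileyTransform β N ≈ baileyTransform γ N
  baileyTransform-cong N β≈γ = sumBelow-cong (suc N) (λ k → *-congʳ (*-congˡ (β≈γ k)))

  baileyWeight*aSeq : ∀ p α k → baileyWeight k * aSeq p α k ≈ aSeq (suc p) α k
  baileyWeight*aSeq p α k = trans (sym (*-assoc _ _ _))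
    (*-congʳ (sym (pow-distribˡ-+-* q (k ℕ.* k ℕ.+ 2 ℕ.* k) (p ℕ.* (k ℕ.* k ℕ.+ 2 ℕ.* k)))))

  baileyWeight-+ : ∀ k t →
    baileyWeight k * pow (pow q (2 ℕ.+ (k ℕ.+ k))) t * pow q (t ℕ.* t) ≈ baileyWeight (k ℕ.+ t)
  baileyWeight-+ k t = begin
    baileyWeight k * pow (pow q (2 ℕ.+ (k ℕ.+ k))) t * pow q (t ℕ.* t)
      ≈⟨ *-assoc _ _ _ ⟩
    baileyWeight k * (pow (pow q (2 ℕ.+ (k ℕ.+ k))) t * pow q (t ℕ.* t))
      ≈⟨ *-congˡ (*-congʳ (pow-*-assoc q (2 ℕ.+ (k ℕ.+ k)) t)) ⟩
    baileyWeight k * (pow q ((2 ℕ.+ (k ℕ.+ k)) ℕ.* t) * pow q (t ℕ.* t))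
      ≈⟨ trans (*-congˡ (sym (pow-distribˡ-+-* q ((2 ℕ.+ (k ℕ.+ k)) ℕ.* t) (t ℕ.* t))))
               (sym (pow-distribˡ-+-* q (k ℕ.* k ℕ.+ 2 ℕ.* k) ((2 ℕ.+ (k ℕ.+ k)) ℕ.* t ℕ.+ t ℕ.* t))) ⟩
    pow q ((k ℕ.* k ℕ.+ 2 ℕ.* k) ℕ.+ ((2 ℕ.+ (k ℕ.+ k)) ℕ.* t ℕ.+ t ℕ.* t))
      ≡⟨ ≡.cong (pow q) (exponent k t) ⟩
    baileyWeight (k ℕ.+ t)
      ∎
    where
    exponent : ∀ k t → (k ℕ.* k ℕ.+ 2 ℕ.* k) ℕ.+ ((2 ℕ.+ (k ℕ.+ k)) ℕ.* t ℕ.+ t ℕ.* t) ≡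
                       (k ℕ.+ t) ℕ.* (k ℕ.+ t) ℕ.+ 2 ℕ.* (k ℕ.+ t)
    exponent = solve-∀

  baileyKernel : ℕ → ℕ → ℕ → Carrier
  baileyKernel k s t = baileyWeight (k ℕ.+ t) * invPoch 0 t * invPoch 2 (k ℕ.+ t ℕ.+ k) * invPoch 0 (s ∸ t)

  baileyTransform-reverse : ∀ N β →
    sumBelow (suc N) (λ t → baileyWeight (N ∸ t) * β (N ∸ t) * invPoch 0 t) ≈ baileyTransform β N
  baileyTransform-reverse N β = sym (trans (sumBelow-reverse (suc N) _)
    (sumBelow-cong< (suc N) (λ t t<1+N → *-congˡ (reflexive (≡.cong (invPoch 0) (ℕ.m∸[m∸n]≡n (ℕ.≤-pred t<1+N)))))))

  lhs-summand : ∀ {M m} β → m ≤ M → f (suc M) m * β (suc M ∸ m ∸ 1) ≈ baileyWeight (M ∸ m) * β (M ∸ m)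
  lhs-summand {M} {m} β m≤M = *-cong
    (pow-congʳ q (≡.trans (≡.cong (λ r → (r ∸ 1) ℕ.* (r ℕ.+ 1)) (ℕ.+-∸-assoc 1 m≤M)) (exponent (M ∸ m))))
    (reflexive (≡.cong β ([1+M]∸m∸1≡M∸m M m)))
    where
    exponent : ∀ r → r ℕ.* (suc r ℕ.+ 1) ≡ r ℕ.* r ℕ.+ 2 ℕ.* r
    exponent = solve-∀

  lhs-one : ∀ β M → lhs β 1 (suc M) ≈ baileyTransform β M
  lhs-one β M = trans
    (sumBelow-cong< (suc M) (λ m m<1+M → trans (*-identityʳ _) (*-congʳ (lhs-summand β (ℕ.≤-pred m<1+M)))))
    (baileyTransform-reverse M β)

  starPart : (ℕ → Carrier) → ℕ → Carrier
  starPart a k = (1# - pow q 2) * (a k * uinv (2 ℕ.* k ℕ.+ 1))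

  star-suc : ∀ a k → star a (suc k) ≈ starPart a (suc k) - pow q (2 ℕ.* suc k) * starPart a k
  star-suc a k = solve 6 (λ t x u g y v → t :* (x :* u :- g :* y :* v) := t :* (x :* u) :- g :* (t :* (y :* v))) refl _ _ _ _ _ _

  sumBelow-star-by-parts : ∀ a (w : ℕ → Carrier) L →
    sumBelow (suc L) (λ k → w k * star a k) ≈
    sumBelow (suc L) (λ k → (w k - pow q (2 ℕ.* suc k) * w (suc k)) * starPart a k) +
    pow q (2 ℕ.* suc L) * w (suc L) * starPart a L
  sumBelow-star-by-parts a w zero    =
    solve 4 (λ w₀ c₀ g₀ w₁ → con (0 , 0) :+ w₀ :* c₀
                             := (con (0 , 0) :+ (w₀ :- g₀ :* w₁) :* c₀) :+ g₀ :* w₁ :* c₀)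
            refl _ _ _ _
  sumBelow-star-by-parts a w (suc L) = begin
    sumBelow (suc L) (λ k → w k * star a k) + w (suc L) * star a (suc L)
      ≈⟨ +-cong (sumBelow-star-by-parts a w L) (*-congˡ (star-suc a L)) ⟩
    (S + g L * w (suc L) * c′ L) + w (suc L) * (c′ (suc L) - g L * c′ L)
      ≈⟨ solve 7 (λ S g₀ w₁ c₀ c₁ g₁ w₂ → (S :+ g₀ :* w₁ :* c₀) :+ w₁ :* (c₁ :- g₀ :* c₀)
                   := (S :+ (w₁ :- g₁ :* w₂) :* c₁) :+ g₁ :* w₂ :* c₁)
               refl S (g L) (w (suc L)) (c′ L) (c′ (suc L)) (g (suc L)) (w (suc (suc L))) ⟩
    (S + (w (suc L) - g (suc L) * w (suc (suc L))) * c′ (suc L)) + g (suc L) * w (suc (suc L)) * c′ (suc L)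
      ∎
    where
    c′ : ℕ → Carrier
    c′ = starPart a
    g : ℕ → Carrier
    g k = pow q (2 ℕ.* suc k)
    S : Carrier
    S = sumBelow (suc L) (λ k → (w k - g k * w (suc k)) * c′ k)

  fallingPoch : ℕ → ℕ → Carrier
  fallingPoch M k = prodBelow k (λ j → 1# - pow q (M ∸ j))

  fallingPoch-vanishes : ∀ M → fallingPoch M (suc M) ≈ 0#
  fallingPoch-vanishes M = begin
    fallingPoch M M * (1# - pow q (M ∸ M))  ≈⟨ *-congˡ (+-congˡ (-‿cong (pow-congʳ q (ℕ.n∸n≡0 M)))) ⟩
    fallingPoch M M * (1# - 1#)             ≈⟨ *-congˡ (-‿inverseʳ 1#) ⟩
    fallingPoch M M * 0#                    ≈⟨ zeroʳ _ ⟩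
    0#                                      ∎

  qPoch≈qPoch*fallingPoch : ∀ {M k} → k ≤ M → qPoch 0 M ≈ qPoch 0 (M ∸ k) * fallingPoch M k
  qPoch≈qPoch*fallingPoch {M} {zero}  _     = sym (*-identityʳ _)
  qPoch≈qPoch*fallingPoch {M} {suc k} k<M = begin
    qPoch 0 M
      ≈⟨ qPoch≈qPoch*fallingPoch (ℕ.<⇒≤ k<M) ⟩
    qPoch 0 (M ∸ k) * fallingPoch M k
      ≡⟨ ≡.cong (λ m → qPoch 0 m * fallingPoch M k) (ℕ.+-∸-assoc 1 k<M) ⟩
    (qPoch 0 (M ∸ suc k) * (1# - pow q (suc (M ∸ suc k)))) * fallingPoch M k
      ≡⟨ ≡.cong (λ m → (qPoch 0 (M ∸ suc k) * (1# - pow q m)) * fallingPoch M k) (ℕ.+-∸-assoc 1 k<M) ⟨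
    (qPoch 0 (M ∸ suc k) * (1# - pow q (M ∸ k))) * fallingPoch M k
      ≈⟨ solve 3 (λ a b c → (a :* b) :* c := a :* (c :* b)) refl _ _ _ ⟩
    qPoch 0 (M ∸ suc k) * fallingPoch M (suc k)
      ∎

  pow-qinv*pow-q≈1 : q * qinv ≈ 1# → ∀ n → pow qinv n * pow q n ≈ 1#
  pow-qinv*pow-q≈1 q*qinv≈1 zero    = *-identityˡ 1#
  pow-qinv*pow-q≈1 q*qinv≈1 (suc n) = begin
    (qinv * pow qinv n) * (q * pow q n)
      ≈⟨ solve 4 (λ a b c d → (a :* b) :* (c :* d) := (c :* a) :* (b :* d)) refl qinv (pow qinv n) q (pow q n) ⟩
    (q * qinv) * (pow qinv n * pow q n)
      ≈⟨ *-cong q*qinv≈1 (pow-qinv*pow-q≈1 q*qinv≈1 n) ⟩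
    1# * 1#
      ≈⟨ *-identityˡ 1# ⟩
    1#
      ∎

  qpow[1-[1+M]]*q^M≈1 : q * qinv ≈ 1# → ∀ M → qpow (+ 1 ℤ.- + suc M) * pow q M ≈ 1#
  qpow[1-[1+M]]*q^M≈1 q*qinv≈1 zero    = *-identityˡ 1#
  qpow[1-[1+M]]*q^M≈1 q*qinv≈1 (suc M) = pow-qinv*pow-q≈1 q*qinv≈1 (suc M)

  poch-reflection : q * qinv ≈ 1# → ∀ {M k} → k ≤ suc M →
    poch (qpow (+ 1 ℤ.- + suc M)) k * pow (- 1#) k * pow q (descendingSum M k) ≈ fallingPoch M k
  poch-reflection q*qinv≈1 {M} {zero}  _         = trans (*-identityʳ _) (*-identityʳ _)
  poch-reflection q*qinv≈1 {M} {suc k} (s≤s k≤M) = begin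
    (P * (1# - x * pow q k)) * (- 1# * σ) * pow q (descendingSum M k ℕ.+ (M ∸ k))
      ≈⟨ *-congˡ (pow-distribˡ-+-* q (descendingSum M k) (M ∸ k)) ⟩
    (P * (1# - x * pow q k)) * (- 1# * σ) * (pow q (descendingSum M k) * e)
      ≈⟨ solve 5 (λ P y σ Q e → (P :* (con (1 , 0) :- y)) :* (con (0 , 1) :* σ) :* (Q :* e) := (P :* σ :* Q) :* (y :* e :- e))
               refl P (x * pow q k) σ (pow q (descendingSum M k)) e ⟩
    (P * σ * pow q (descendingSum M k)) * (x * pow q k * e - e)
      ≈⟨ *-cong (poch-reflection q*qinv≈1 (ℕ.m≤n⇒m≤1+n k≤M)) (+-congʳ x·qᵏ·qᴹ⁻ᵏ≈1) ⟩
    fallingPoch M k * (1# - e)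
      ∎
    where
    x : Carrier
    x = qpow (+ 1 ℤ.- + suc M)
    P : Carrier
    P = poch x k
    σ : Carrier
    σ = pow (- 1#) k
    e : Carrier
    e = pow q (M ∸ k)
    x·qᵏ·qᴹ⁻ᵏ≈1 : x * pow q k * e ≈ 1#
    x·qᵏ·qᴹ⁻ᵏ≈1 = begin
      x * pow q k * e         ≈⟨ *-assoc _ _ _ ⟩
      x * (pow q k * e)       ≈⟨ *-congˡ (pow-distribˡ-+-* q k (M ∸ k)) ⟨
      x * pow q (k ℕ.+ (M ∸ k)) ≡⟨ ≡.cong (λ m → x * pow q m) (ℕ.m+[n∸m]≡n k≤M) ⟩
      x * pow q M             ≈⟨ qpow[1-[1+M]]*q^M≈1 q*qinv≈1 M ⟩
      1#                      ∎

  rhsWeight : ℕ → ℕ → Carrier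
  rhsWeight n k = poch (qpow (+ 1 ℤ.- + n)) k * invPoch n k * pow (- 1#) k * pow q (n ℕ.* k ∸ (suc k C 2))

  rhsWeight≈fallingPoch*invPoch : q * qinv ≈ 1# → ∀ {M k} → k ≤ suc M →
    rhsWeight (suc M) k ≈ fallingPoch M k * invPoch (suc M) k
  rhsWeight≈fallingPoch*invPoch q*qinv≈1 {M} {k} k≤1+M = begin
    P * V * σ * pow q (suc M ℕ.* k ∸ suc k C 2)
      ≡⟨ ≡.cong (λ m → P * V * σ * pow q m) ([1+M]*k∸[1+k]C2≡descendingSum k≤1+M) ⟩
    P * V * σ * pow q (descendingSum M k)
      ≈⟨ solve 4 (λ P V σ Q → P :* V :* σ :* Q := P :* σ :* Q :* V) refl _ _ _ _ ⟩
    P * σ * pow q (descendingSum M k) * V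
      ≈⟨ *-congʳ (poch-reflection q*qinv≈1 k≤1+M) ⟩
    fallingPoch M k * V
      ∎
    where
    P : Carrier
    P = poch (qpow (+ 1 ℤ.- + suc M)) k
    V : Carrier
    V = invPoch (suc M) k
    σ : Carrier
    σ = pow (- 1#) k

  module WithInverses (uinv-inverse : ∀ m → (1# - pow q (suc m)) * uinv m ≈ 1#) where

    qPoch*invPoch≈1 : ∀ s n → qPoch s n * invPoch s n ≈ 1#
    qPoch*invPoch≈1 s zero    = *-identityˡ 1#
    qPoch*invPoch≈1 s (suc n) = begin
      (qPoch s n * d) * (invPoch s n * u)  ≈⟨ solve 4 (λ a b c e → (a :* b) :* (c :* e) := (a :* c) :* (b :* e)) refl _ _ _ _ ⟩
      (qPoch s n * invPoch s n) * (d * u)  ≈⟨ *-cong (qPoch*invPoch≈1 s n) (uinv-inverse (s ℕ.+ n)) ⟩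
      1# * 1#                              ≈⟨ *-identityˡ 1# ⟩
      1#                                   ∎
      where
      d : Carrier
      d = 1# - pow q (suc (s ℕ.+ n))
      u : Carrier
      u = uinv (s ℕ.+ n)

    invPoch*qPoch≈1 : ∀ s n → invPoch s n * qPoch s n ≈ 1#
    invPoch*qPoch≈1 s n = trans (*-comm _ _) (qPoch*invPoch≈1 s n)

    gauss≈qbinom : ∀ {s t} → t ≤ s → gauss s t ≈ qbinom s t
    gauss≈qbinom {s} {t} t≤s = begin
      gauss s t
        ≈⟨ *-identityʳ _ ⟨
      gauss s t * 1#
        ≈⟨ *-congˡ (trans (*-cong (qPoch*invPoch≈1 0 t) (qPoch*invPoch≈1 0 (s ∸ t))) (*-identityˡ 1#)) ⟨
      gauss s t * ((qPoch 0 t * invPoch 0 t) * (qPoch 0 (s ∸ t) * invPoch 0 (s ∸ t)))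
        ≈⟨ solve 5 (λ g a b c d → g :* ((a :* b) :* (c :* d)) := (g :* a :* c) :* d :* b) refl _ _ _ _ _ ⟩
      (gauss s t * qPoch 0 t * qPoch 0 (s ∸ t)) * invPoch 0 (s ∸ t) * invPoch 0 t
        ≈⟨ *-congʳ (*-congʳ (gauss*qPoch*qPoch t≤s)) ⟩
      qbinom s t
        ∎

    baileyKernel≈qBernstein : ∀ k {s t} → t ≤ s →
      baileyWeight k * invPoch 0 s * invPoch 2 (k ℕ.+ s ℕ.+ k) * qBernstein s (pow q (2 ℕ.+ (k ℕ.+ k))) t ≈
      baileyKernel k s t
    baileyKernel≈qBernstein k {s} {t} t≤s = begin
      (baileyWeight k * invPoch 0 s * invPoch 2 (k ℕ.+ s ℕ.+ k)) * (gauss s t * pow A t * pow q (t ℕ.* t) * poch (A * pow q (suc t)) (s ∸ t))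
        ≈⟨ *-cong (*-congˡ split) (*-cong (*-congʳ (*-congʳ (gauss≈qbinom t≤s))) P≈qPoch) ⟩
      (baileyWeight k * invPoch 0 s * (Uₜ * V)) * (qPoch 0 s * U₀ₛ₋ₜ * U₀ₜ * pow A t * pow q (t ℕ.* t) * qPoch r (s ∸ t))
        ≈⟨ solve 10 (λ w u₀ₛ Uₜ V D₀ₛ U₀ₛ₋ₜ U₀ₜ Aᵗ qᵗᵗ Dᵣ →
                      (w :* u₀ₛ :* (Uₜ :* V)) :* (D₀ₛ :* U₀ₛ₋ₜ :* U₀ₜ :* Aᵗ :* qᵗᵗ :* Dᵣ)
                      := ((u₀ₛ :* D₀ₛ) :* (V :* Dᵣ)) :* (w :* Aᵗ :* qᵗᵗ :* U₀ₜ :* Uₜ :* U₀ₛ₋ₜ))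
                    refl (baileyWeight k) (invPoch 0 s) Uₜ V (qPoch 0 s) U₀ₛ₋ₜ U₀ₜ (pow A t) (pow q (t ℕ.* t)) (qPoch r (s ∸ t)) ⟩
      ((invPoch 0 s * qPoch 0 s) * (V * qPoch r (s ∸ t))) * (baileyWeight k * pow A t * pow q (t ℕ.* t) * U₀ₜ * Uₜ * U₀ₛ₋ₜ)
        ≈⟨ *-cong (trans (*-cong (invPoch*qPoch≈1 0 s) (invPoch*qPoch≈1 r (s ∸ t))) (*-identityˡ 1#))
                  (*-congʳ (*-congʳ (*-congʳ (baileyWeight-+ k t)))) ⟩
      1# * baileyKernel k s t
        ≈⟨ *-identityˡ _ ⟩
      baileyKernel k s t
        ∎
      where
      A : Carrier
      A = pow q (2 ℕ.+ (k ℕ.+ k))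
      r : ℕ
      r = 2 ℕ.+ (k ℕ.+ t ℕ.+ k)
      Uₜ : Carrier
      Uₜ = invPoch 2 (k ℕ.+ t ℕ.+ k)
      V : Carrier
      V = invPoch r (s ∸ t)
      U₀ₜ : Carrier
      U₀ₜ = invPoch 0 t
      U₀ₛ₋ₜ : Carrier
      U₀ₛ₋ₜ = invPoch 0 (s ∸ t)
      split : invPoch 2 (k ℕ.+ s ℕ.+ k) ≈ Uₜ * V
      split = begin
        invPoch 2 (k ℕ.+ s ℕ.+ k)                 ≡⟨ ≡.cong (λ m → invPoch 2 (k ℕ.+ m ℕ.+ k)) (ℕ.m+[n∸m]≡n t≤s) ⟨
        invPoch 2 (k ℕ.+ (t ℕ.+ (s ∸ t)) ℕ.+ k)   ≡⟨ ≡.cong (invPoch 2) (regroup k t (s ∸ t)) ⟩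
        invPoch 2 ((k ℕ.+ t ℕ.+ k) ℕ.+ (s ∸ t))   ≈⟨ invPoch-+ 2 (k ℕ.+ t ℕ.+ k) (s ∸ t) ⟩
        Uₜ * V                                    ∎
        where
        regroup : ∀ k t u → k ℕ.+ (t ℕ.+ u) ℕ.+ k ≡ (k ℕ.+ t ℕ.+ k) ℕ.+ u
        regroup = solve-∀
      P≈qPoch : poch (A * pow q (suc t)) (s ∸ t) ≈ qPoch r (s ∸ t)
      P≈qPoch = trans (poch-congˡ (s ∸ t) (trans (sym (pow-distribˡ-+-* q (2 ℕ.+ (k ℕ.+ k)) (suc t))) (pow-congʳ q (exponent k t))))
                      (poch-pow≈qPoch r (s ∸ t))
        where
        exponent : ∀ k t → 2 ℕ.+ (k ℕ.+ k) ℕ.+ suc t ≡ suc (2 ℕ.+ (k ℕ.+ t ℕ.+ k))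
        exponent = solve-∀

    baileyKernel-sum : ∀ k s →
      sumBelow (suc s) (baileyKernel k s) ≈ baileyWeight k * invPoch 0 s * invPoch 2 (k ℕ.+ s ℕ.+ k)
    baileyKernel-sum k s = begin
      sumBelow (suc s) (baileyKernel k s)
        ≈⟨ sumBelow-cong< (suc s) (λ t t<1+s → baileyKernel≈qBernstein k (ℕ.≤-pred t<1+s)) ⟨
      sumBelow (suc s) (λ t → K * qBernstein s (pow q (2 ℕ.+ (k ℕ.+ k))) t)
        ≈⟨ *-distribˡ-sumBelow (suc s) K _ ⟨
      K * sumBelow (suc s) (qBernstein s (pow q (2 ℕ.+ (k ℕ.+ k))))
        ≈⟨ *-congˡ (qBernstein-sum s _) ⟩
      K * 1#
        ≈⟨ *-identityʳ K ⟩
      K ∎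
      where
      K : Carrier
      K = baileyWeight k * invPoch 0 s * invPoch 2 (k ℕ.+ s ℕ.+ k)

    baileyTransform-baileyβ : ∀ α N →
      baileyTransform (baileyβ α) N ≈ baileyβ (λ k → baileyWeight k * α k) N
    baileyTransform-baileyβ α N = begin
      baileyTransform (baileyβ α) N
        ≈⟨ sumBelow-cong (suc N) expand ⟩
      sumBelow (suc N) (λ K → sumBelow (suc K) (g K))
        ≈⟨ sumBelow-triangle-comm (suc N) g ⟩
      sumBelow (suc N) (λ k → sumBelow (suc N ∸ k) (λ t → g (k ℕ.+ t) k))
        ≈⟨ sumBelow-cong< (suc N) (λ k k<1+N → collapse (ℕ.≤-pred k<1+N)) ⟩
      baileyβ (λ k → baileyWeight k * α k) N
        ∎
      where
      g : ℕ → ℕ → Carrier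
      g K k = α k * (baileyWeight K * invPoch 0 (K ∸ k) * invPoch 2 (K ℕ.+ k) * invPoch 0 (N ∸ K))
      expand : ∀ K → baileyWeight K * baileyβ α K * invPoch 0 (N ∸ K) ≈ sumBelow (suc K) (g K)
      expand K = begin
        w * baileyβ α K * u
          ≈⟨ solve 3 (λ a b c → a :* b :* c := (a :* c) :* b) refl _ _ _ ⟩
        (w * u) * baileyβ α K
          ≈⟨ *-distribˡ-sumBelow (suc K) _ _ ⟩
        sumBelow (suc K) (λ k → (w * u) * (α k * invPoch 0 (K ∸ k) * invPoch 2 (K ℕ.+ k)))
          ≈⟨ sumBelow-cong (suc K) (λ k →
               solve 5 (λ w u a x y → (w :* u) :* (a :* x :* y) := a :* (w :* x :* y :* u)) refl _ _ _ _ _) ⟩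
        sumBelow (suc K) (g K)
          ∎
        where
        w : Carrier
        w = baileyWeight K
        u : Carrier
        u = invPoch 0 (N ∸ K)
      collapse : ∀ {k} → k ≤ N →
        sumBelow (suc N ∸ k) (λ t → g (k ℕ.+ t) k) ≈ baileyWeight k * α k * invPoch 0 (N ∸ k) * invPoch 2 (N ℕ.+ k)
      collapse {k} k≤N = begin
        sumBelow (suc N ∸ k) (λ t → g (k ℕ.+ t) k)
          ≡⟨ ≡.cong (λ m → sumBelow m (λ t → g (k ℕ.+ t) k)) (ℕ.+-∸-assoc 1 k≤N) ⟩
        sumBelow (suc (N ∸ k)) (λ t → g (k ℕ.+ t) k)
          ≈⟨ sumBelow-cong (suc (N ∸ k)) (λ t → *-congˡ (reindex t)) ⟩
        sumBelow (suc (N ∸ k)) (λ t → α k * baileyKernel k (N ∸ k) t)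
          ≈⟨ *-distribˡ-sumBelow (suc (N ∸ k)) (α k) _ ⟨
        α k * sumBelow (suc (N ∸ k)) (baileyKernel k (N ∸ k))
          ≈⟨ *-congˡ (baileyKernel-sum k (N ∸ k)) ⟩
        α k * (baileyWeight k * invPoch 0 (N ∸ k) * invPoch 2 (k ℕ.+ (N ∸ k) ℕ.+ k))
          ≡⟨ ≡.cong (λ m → α k * (baileyWeight k * invPoch 0 (N ∸ k) * invPoch 2 (m ℕ.+ k))) (ℕ.m+[n∸m]≡n k≤N) ⟩
        α k * (baileyWeight k * invPoch 0 (N ∸ k) * invPoch 2 (N ℕ.+ k))
          ≈⟨ solve 4 (λ a w x y → a :* (w :* x :* y) := w :* a :* x :* y) refl _ _ _ _ ⟩
        baileyWeight k * α k * invPoch 0 (N ∸ k) * invPoch 2 (N ℕ.+ k)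
          ∎
        where
        reindex : ∀ t → baileyWeight (k ℕ.+ t) * invPoch 0 (k ℕ.+ t ∸ k) * invPoch 2 (k ℕ.+ t ℕ.+ k) * invPoch 0 (N ∸ (k ℕ.+ t)) ≈
                        baileyKernel k (N ∸ k) t
        reindex t = *-cong (*-congʳ (*-congˡ (reflexive (≡.cong (invPoch 0) (ℕ.m+n∸m≡n k t)))))
                           (reflexive (≡.cong (invPoch 0) (≡.sym (ℕ.∸-+-assoc N k t))))

    isBaileyPair-aSeq : ∀ p {α β} → IsBaileyPairQ² (aSeq p α) β →
                        IsBaileyPairQ² (aSeq (suc p) α) (baileyTransform β)
    isBaileyPair-aSeq p {α} {β} isPair N = begin
      baileyTransform β N                            ≈⟨ baileyTransform-cong N isPair ⟩
      baileyTransform (baileyβ (aSeq p α)) N         ≈⟨ baileyTransform-baileyβ (aSeq p α) N ⟩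
      baileyβ (λ k → baileyWeight k * aSeq p α k) N  ≈⟨ baileyβ-cong N (baileyWeight*aSeq p α) ⟩
      baileyβ (aSeq (suc p) α) N                     ∎

    peelTerm : (ℕ → Carrier) → ℕ → ℕ → ℕ → ℕ → Carrier
    peelTerm β j M m l =
      baileyWeight (M ∸ m) * β (M ∸ m) * invPoch 0 (m ∸ l) * (f (suc M) l * invPoch 0 l * W (suc M) j l)

    lhs-summand-expand : ∀ β j {M m} → m ≤ M →
      f (suc M) m * β (suc M ∸ m ∸ 1) * invPoch 0 m * W (suc M) (suc j) m ≈ sumBelow (suc m) (peelTerm β j M m)
    lhs-summand-expand β j {M} {m} m≤M = begin
      f n m * β (n ∸ m ∸ 1) * invPoch 0 m * W n (suc j) m
        ≈⟨ *-congʳ (*-congʳ (lhs-summand β m≤M)) ⟩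
      X * sumBelow (suc m) (λ l → f n l * qbinom m l * W n j l)
        ≈⟨ *-distribˡ-sumBelow (suc m) X _ ⟩
      sumBelow (suc m) (λ l → X * (f n l * qbinom m l * W n j l))
        ≈⟨ sumBelow-cong (suc m) cancel ⟩
      sumBelow (suc m) (peelTerm β j M m)
        ∎
      where
      n : ℕ
      n = suc M
      X : Carrier
      X = baileyWeight (M ∸ m) * β (M ∸ m) * invPoch 0 m
      cancel : ∀ l → X * (f n l * qbinom m l * W n j l) ≈ peelTerm β j M m l
      cancel l = begin
        X * (f n l * (qPoch 0 m * invPoch 0 (m ∸ l) * invPoch 0 l) * W n j l)
          ≈⟨ solve 8 (λ w b u fₗ d uₘₗ uₗ Wₗ → (w :* b :* u) :* (fₗ :* (d :* uₘₗ :* uₗ) :* Wₗ)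
                                                := (u :* d) :* (w :* b :* uₘₗ :* (fₗ :* uₗ :* Wₗ)))
                   refl _ _ _ _ _ _ _ _ ⟩
        (invPoch 0 m * qPoch 0 m) * peelTerm β j M m l
          ≈⟨ trans (*-congʳ (invPoch*qPoch≈1 0 m)) (*-identityˡ _) ⟩
        peelTerm β j M m l
          ∎

    peelTerm-column-sum : ∀ β j {M l} → l ≤ M →
      sumBelow (suc M ∸ l) (λ t → peelTerm β j M (l ℕ.+ t) l) ≈
      f (suc M) l * baileyTransform β (suc M ∸ l ∸ 1) * invPoch 0 l * W (suc M) j l
    peelTerm-column-sum β j {M} {l} l≤M = begin
      sumBelow (suc M ∸ l) (λ t → peelTerm β j M (l ℕ.+ t) l)
        ≡⟨ ≡.cong (λ m → sumBelow m (λ t → peelTerm β j M (l ℕ.+ t) l)) (ℕ.+-∸-assoc 1 l≤M) ⟩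
      sumBelow (suc (M ∸ l)) (λ t → peelTerm β j M (l ℕ.+ t) l)
        ≈⟨ sumBelow-cong (suc (M ∸ l)) (λ t → *-congʳ (reindex t)) ⟩
      sumBelow (suc (M ∸ l)) (λ t → baileyWeight (M ∸ l ∸ t) * β (M ∸ l ∸ t) * invPoch 0 t * inner)
        ≈⟨ *-distribʳ-sumBelow (suc (M ∸ l)) inner _ ⟨
      sumBelow (suc (M ∸ l)) (λ t → baileyWeight (M ∸ l ∸ t) * β (M ∸ l ∸ t) * invPoch 0 t) * inner
        ≈⟨ *-congʳ (baileyTransform-reverse (M ∸ l) β) ⟩
      baileyTransform β (M ∸ l) * inner
        ≡⟨ ≡.cong (λ r → baileyTransform β r * inner) ([1+M]∸m∸1≡M∸m M l) ⟨
      baileyTransform β (suc M ∸ l ∸ 1) * inner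
        ≈⟨ solve 4 (λ b fₗ uₗ Wₗ → b :* (fₗ :* uₗ :* Wₗ) := fₗ :* b :* uₗ :* Wₗ) refl _ _ _ _ ⟩
      f (suc M) l * baileyTransform β (suc M ∸ l ∸ 1) * invPoch 0 l * W (suc M) j l
        ∎
      where
      inner : Carrier
      inner = f (suc M) l * invPoch 0 l * W (suc M) j l
      reindex : ∀ t → baileyWeight (M ∸ (l ℕ.+ t)) * β (M ∸ (l ℕ.+ t)) * invPoch 0 (l ℕ.+ t ∸ l) ≈
                      baileyWeight (M ∸ l ∸ t) * β (M ∸ l ∸ t) * invPoch 0 t
      reindex t rewrite ℕ.∸-+-assoc M l t | ℕ.m+n∸m≡n l t = refl

    lhs-peel : ∀ β j M → lhs β (suc (suc j)) (suc M) ≈ lhs (baileyTransform β) (suc j) (suc M)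
    lhs-peel β j M = begin
      lhs β (suc (suc j)) (suc M)
        ≈⟨ sumBelow-cong< (suc M) (λ m m<1+M → lhs-summand-expand β j (ℕ.≤-pred m<1+M)) ⟩
      sumBelow (suc M) (λ m → sumBelow (suc m) (peelTerm β j M m))
        ≈⟨ sumBelow-triangle-comm (suc M) (peelTerm β j M) ⟩
      sumBelow (suc M) (λ l → sumBelow (suc M ∸ l) (λ t → peelTerm β j M (l ℕ.+ t) l))
        ≈⟨ sumBelow-cong< (suc M) (λ l l<1+M → peelTerm-column-sum β j (ℕ.≤-pred l<1+M)) ⟩
      lhs (baileyTransform β) (suc j) (suc M)
        ∎

    lhs≈baileyβ : ∀ {α β} p → IsBaileyPairQ² (aSeq p α) β →
                  ∀ j M → lhs β (suc j) (suc M) ≈ baileyβ (aSeq (p ℕ.+ suc j) α) M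
    lhs≈baileyβ {α} {β} p isPair zero    M = begin
      lhs β 1 (suc M)              ≈⟨ lhs-one β M ⟩
      baileyTransform β M          ≈⟨ isBaileyPair-aSeq p isPair M ⟩
      baileyβ (aSeq (suc p) α) M   ≡⟨ ≡.cong (λ i → baileyβ (aSeq i α) M) (ℕ.+-comm 1 p) ⟩
      baileyβ (aSeq (p ℕ.+ 1) α) M ∎
    lhs≈baileyβ {α} {β} p isPair (suc j) M = begin
      lhs β (suc (suc j)) (suc M)                    ≈⟨ lhs-peel β j M ⟩
      lhs (baileyTransform β) (suc j) (suc M)        ≈⟨ lhs≈baileyβ (suc p) (isBaileyPair-aSeq p isPair) j M ⟩
      baileyβ (aSeq (suc p ℕ.+ suc j) α) M           ≡⟨ ≡.cong (λ i → baileyβ (aSeq i α) M) (ℕ.+-suc p (suc j)) ⟨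
      baileyβ (aSeq (p ℕ.+ suc (suc j)) α) M         ∎

    invPoch*fallingPoch : ∀ {M k} → k ≤ M → invPoch 0 M * fallingPoch M k ≈ invPoch 0 (M ∸ k)
    invPoch*fallingPoch {M} {k} k≤M = begin
      invPoch 0 M * fallingPoch M k
        ≈⟨ trans (*-congˡ (qPoch*invPoch≈1 0 (M ∸ k))) (*-identityʳ _) ⟨
      invPoch 0 M * fallingPoch M k * (qPoch 0 (M ∸ k) * invPoch 0 (M ∸ k))
        ≈⟨ solve 4 (λ u p d v → u :* p :* (d :* v) := u :* (d :* p) :* v) refl _ _ _ _ ⟩
      invPoch 0 M * (qPoch 0 (M ∸ k) * fallingPoch M k) * invPoch 0 (M ∸ k)
        ≈⟨ *-congʳ (*-congˡ (qPoch≈qPoch*fallingPoch k≤M)) ⟨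
      invPoch 0 M * qPoch 0 M * invPoch 0 (M ∸ k)
        ≈⟨ trans (*-congʳ (invPoch*qPoch≈1 0 M)) (*-identityˡ _) ⟩
      invPoch 0 (M ∸ k)
        ∎

    invPoch-merge : ∀ M k →
      invPoch 1 M * invPoch (suc M) k * uinv (suc M ℕ.+ k) * (1# - pow q 2) ≈ invPoch 2 (M ℕ.+ k)
    invPoch-merge M k = begin
      invPoch 1 M * invPoch (suc M) k * uinv (suc M ℕ.+ k) * (1# - pow q 2)
        ≈⟨ *-congʳ (*-congʳ (invPoch-+ 1 M k)) ⟨
      invPoch 1 (suc (M ℕ.+ k)) * (1# - pow q 2)
        ≈⟨ *-congʳ (invPoch-sucˡ 1 (M ℕ.+ k)) ⟩
      uinv 1 * invPoch 2 (M ℕ.+ k) * (1# - pow q 2)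
        ≈⟨ solve 3 (λ a b c → a :* b :* c := (c :* a) :* b) refl _ _ _ ⟩
      ((1# - pow q 2) * uinv 1) * invPoch 2 (M ℕ.+ k)
        ≈⟨ trans (*-congʳ (uinv-inverse 1)) (*-identityˡ _) ⟩
      invPoch 2 (M ℕ.+ k)
        ∎

    by-parts-summand : ∀ a {M k} → k ≤ M →
      let w = λ i → fallingPoch M i * invPoch (suc M) i in
      invPoch 0 M * invPoch 1 M * ((w k - pow q (2 ℕ.* suc k) * w (suc k)) * starPart a k) ≈
      a k * invPoch 0 (M ∸ k) * invPoch 2 (M ℕ.+ k)
    by-parts-summand a {M} {k} k≤M = begin
      U₀ * U₁ * ((P * V - g * (P * (1# - e) * (V * u))) * (t * (a k * z)))
        ≈⟨ solve 10 (λ U₀ U₁ P V u g e t aₖ z →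
              U₀ :* U₁ :* ((P :* V :- g :* (P :* (con (1 , 0) :- e) :* (V :* u))) :* (t :* (aₖ :* z)))
              := U₀ :* U₁ :* (P :* V :* (con (1 , 0) :- u :* (con (1 , 0) :- g :* e))) :* (t :* (aₖ :* z))
                 :+ (U₀ :* P) :* (U₁ :* V :* u :* t) :* aₖ :* ((con (1 , 0) :- g) :* z))
              refl U₀ U₁ P V u g e t (a k) z ⟩
      U₀ * U₁ * (P * V * (1# - u * (1# - g * e))) * (t * (a k * z)) + (U₀ * P) * (U₁ * V * u * t) * a k * ((1# - g) * z)
        ≈⟨ +-cong (*-congʳ (*-congˡ (*-congˡ (trans (+-congˡ (-‿cong u·[1-g·e]≈1)) (-‿inverseʳ 1#)))))
                  (*-cong (*-congʳ (*-cong (invPoch*fallingPoch k≤M) (invPoch-merge M k))) [1-g]·z≈1) ⟩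
      U₀ * U₁ * (P * V * 0#) * (t * (a k * z)) + invPoch 0 (M ∸ k) * invPoch 2 (M ℕ.+ k) * a k * 1#
        ≈⟨ solve 9 (λ U₀ U₁ P V t aₖ z x y → U₀ :* U₁ :* (P :* V :* con (0 , 0)) :* (t :* (aₖ :* z)) :+ x :* y :* aₖ :* con (1 , 0)
                                            := aₖ :* x :* y)
                 refl U₀ U₁ P V t (a k) z (invPoch 0 (M ∸ k)) (invPoch 2 (M ℕ.+ k)) ⟩
      a k * invPoch 0 (M ∸ k) * invPoch 2 (M ℕ.+ k)
        ∎
      where
      U₀ U₁ P V u g e t z : Carrier
      U₀ = invPoch 0 M
      U₁ = invPoch 1 M
      P = fallingPoch M k
      V = invPoch (suc M) k
      u = uinv (suc M ℕ.+ k)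
      g = pow q (2 ℕ.* suc k)
      e = pow q (M ∸ k)
      t = 1# - pow q 2
      z = uinv (2 ℕ.* k ℕ.+ 1)
      u·[1-g·e]≈1 : u * (1# - g * e) ≈ 1#
      u·[1-g·e]≈1 = begin
        u * (1# - g * e)                   ≈⟨ *-comm _ _ ⟩
        (1# - g * e) * u                   ≈⟨ *-congʳ (+-congˡ (-‿cong (pow-distribˡ-+-* q (2 ℕ.* suc k) (M ∸ k)))) ⟨
        (1# - pow q (2 ℕ.* suc k ℕ.+ (M ∸ k))) * u
          ≡⟨ ≡.cong (λ m → (1# - pow q m) * u) (≡.trans (exponent k (M ∸ k)) (≡.cong (λ r → suc (suc r ℕ.+ k)) (ℕ.m+[n∸m]≡n k≤M))) ⟩
        (1# - pow q (suc (suc M ℕ.+ k))) * u ≈⟨ uinv-inverse (suc M ℕ.+ k) ⟩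
        1#                                 ∎
        where
        exponent : ∀ k r → 2 ℕ.* suc k ℕ.+ r ≡ suc (suc (k ℕ.+ r) ℕ.+ k)
        exponent = solve-∀
      [1-g]·z≈1 : (1# - g) * z ≈ 1#
      [1-g]·z≈1 = trans (*-congʳ (+-congˡ (-‿cong (pow-congʳ q (exponent k))))) (uinv-inverse (2 ℕ.* k ℕ.+ 1))
        where
        exponent : ∀ k → 2 ℕ.* suc k ≡ suc (2 ℕ.* k ℕ.+ 1)
        exponent = solve-∀

    baileyβ≈rhsSum : q * qinv ≈ 1# → ∀ a M →
      baileyβ a M ≈ invPoch 0 M * invPoch 1 M * sumBelow (suc M) (λ k → rhsWeight (suc M) k * star a k)
    baileyβ≈rhsSum q*qinv≈1 a M = sym (begin
      U * sumBelow (suc M) (λ k → rhsWeight (suc M) k * star a k)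
        ≈⟨ *-congˡ (sumBelow-star-by-parts a (rhsWeight (suc M)) M) ⟩
      U * (sumBelow (suc M) (λ k → (rhsWeight (suc M) k - g k * rhsWeight (suc M) (suc k)) * starPart a k) +
           g M * rhsWeight (suc M) (suc M) * starPart a M)
        ≈⟨ *-congˡ (+-cong (sumBelow-cong< (suc M) (λ k k<1+M → *-congʳ (+-cong (weight (ℕ.<⇒≤ k<1+M)) (-‿cong (*-congˡ (weight k<1+M))))))
                           (*-congʳ (trans (*-congˡ (trans (weight ℕ.≤-refl) (*-congʳ (fallingPoch-vanishes M)))) (trans (*-congˡ (zeroˡ _)) (zeroʳ _))))) ⟩
      U * (sumBelow (suc M) (λ k → (w k - g k * w (suc k)) * starPart a k) + 0# * starPart a M)
        ≈⟨ *-congˡ (trans (+-congˡ (zeroˡ _)) (+-identityʳ _)) ⟩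
      U * sumBelow (suc M) (λ k → (w k - g k * w (suc k)) * starPart a k)
        ≈⟨ *-distribˡ-sumBelow (suc M) U _ ⟩
      sumBelow (suc M) (λ k → U * ((w k - g k * w (suc k)) * starPart a k))
        ≈⟨ sumBelow-cong< (suc M) (λ k k<1+M → by-parts-summand a (ℕ.≤-pred k<1+M)) ⟩
      baileyβ a M
        ∎)
      where
      U : Carrier
      U = invPoch 0 M * invPoch 1 M
      g w : ℕ → Carrier
      g k = pow q (2 ℕ.* suc k)
      w k = fallingPoch M k * invPoch (suc M) k
      weight : ∀ {k} → k ≤ suc M → rhsWeight (suc M) k ≈ w k
      weight = rhsWeight≈fallingPoch*invPoch q*qinv≈1

proposition2p4 : ∀ {c ℓ} (R : CommutativeRing c ℓ) →
    let open CommutativeRing R in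
    (q qinv : Carrier) (uinv : ℕ → Carrier) →
    q * qinv ≈ 1# →
    (∀ m → (1# - QSeries.pow R q qinv uinv q (suc m)) * uinv m ≈ 1#) →
    (α β : ℕ → Carrier) →
    QSeries.IsBaileyPairQ² R q qinv uinv α β →
    (p n : ℕ) → 1 ≤ p → 1 ≤ n →
    QSeries.lhs R q qinv uinv β p n ≈ QSeries.rhs R q qinv uinv α p n
proposition2p4 R q qinv uinv q*qinv≈1 uinv-inverse α β isPair (suc j) (suc M) _ _ = begin
    lhs β (suc j) (suc M)       ≈⟨ lhs≈baileyβ 0 isPair₀ j M ⟩
    baileyβ (aSeq (suc j) α) M  ≈⟨ baileyβ≈rhsSum q*qinv≈1 (aSeq (suc j) α) M ⟩
    rhs α (suc j) (suc M)       ∎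
  where
  open CommutativeRing R hiding (zero)
  open QSeries R q qinv uinv
  open QSeriesProperties R q qinv uinv
  open WithInverses uinv-inverse
  open SetoidReasoning setoid
  isPair₀ : IsBaileyPairQ² (aSeq 0 α) β
  isPair₀ N = trans (isPair N) (baileyβ-cong N (λ k → sym (*-identityˡ (α k))))
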